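{- Let $J$ be an $h$-perfect graph that is not perfect, let $2\ell+1$ be the length of a shortest odd hole in $J$, and let $\lambda_\ell=\frac{2\ell}{2\ell+1}$. Let $P(J)=\{x\in\mathbb R_{\ge0}^{V(J)}: x(Q)\le1\text{ for every clique }Q\subseteq V(J)\}$. Then $\lambda_\ell P(J)\subseteq\mathrm{STAB}(J)$.
   Context: $x(Q)=\sum_{v\in Q}x_v$. $\mathrm{STAB}(J)$ is the convex hull of incidence vectors of stable sets of $J$. A graph is $h$-perfect if its stable set polytope is described by nonnegativity, clique inequalities $x(Q)\le1$, and odd-hole inequalities $x(V(C))\le(|V(C)|-1)/2$ for odd holes (induced odd cycles of length at least 5) $C$.
   Formalization: The points x have rational coordinates instead of real ones, and h-perfectness and membership in STAB(J), with rational convex coefficients, are likewise stated only for rational points. -}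

module Defs where

open import Data.Nat using (ℕ; zero; suc; _+_; _*_; _∸_; _≤_; _%_)
open import Data.Bool using (Bool; true; false; if_then_else_)
open import Data.Fin using (Fin; toℕ)
open import Data.Fin.Subset using (Subset; _∈_; _⊆_; ∣_∣)
open import Data.Fin.Subset.Properties using (_∈?_)
open import Data.Integer using (+_)
open import Data.Rational using (ℚ; 0ℚ; 1ℚ; _/_) renaming (_+_ to _+ℚ_; _*_ to _*ℚ_; _≤_ to _≤ℚ_)
open import Data.List using (List; []; _∷_) renaming (foldr to foldrL)
open import Data.List.Relation.Unary.All using (All)
open import Data.Product using (Σ; ∃; ∃-syntax; _×_; _,_; proj₁; proj₂)
open import Data.Sum using (_⊎_)
open import Relation.Nullary using (¬_; does)
open import Relation.Binary.PropositionalEquality using (_≡_; _≢_)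
open import Function.Definitions using (Injective)
open import Data.Vec.Functional using () renaming (foldr to foldrF)

record Graph (n : ℕ) : Set where
  field
    adj   : Fin n → Fin n → Bool
    sym   : ∀ i j → adj i j ≡ adj j i
    irrefl : ∀ i → adj i i ≡ false
open Graph public

Adj : ∀ {n} → Graph n → Fin n → Fin n → Set
Adj G i j = adj G i j ≡ true

IsClique : ∀ {n} → Graph n → Subset n → Set
IsClique G Q = ∀ i j → i ∈ Q → j ∈ Q → i ≢ j → Adj G i j

IsStable : ∀ {n} → Graph n → Subset n → Set
IsStable G S = ∀ i j → i ∈ S → j ∈ S → ¬ Adj G i j

sumFin : ∀ {k} → (Fin k → ℚ) → ℚ
sumFin f = foldrF _+ℚ_ 0ℚ f

xSum : ∀ {n} → (Fin n → ℚ) → Subset n → ℚ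
xSum x Q = sumFin (λ i → if does (i ∈? Q) then x i else 0ℚ)

χ : ∀ {n} → Subset n → Fin n → ℚ
χ S i = if does (i ∈? S) then 1ℚ else 0ℚ

CycAdj : ∀ {k} → Fin k → Fin k → Set
CycAdj {k} i j = Succ i j ⊎ Succ j i
  where
  Succ : Fin k → Fin k → Set
  Succ a b = (toℕ b ≡ suc (toℕ a)) ⊎ ((suc (toℕ a) ≡ k) × (toℕ b ≡ 0))

Odd : ℕ → Set
Odd k = ∃[ m ] k ≡ suc (2 * m)

record OddHole {n} (G : Graph n) (k : ℕ) : Set where
  field
    c      : Fin k → Fin n
    c-inj  : Injective _≡_ _≡_ c
    odd    : Odd k
    len≥5  : 5 ≤ k
    induced-to   : ∀ i j → CycAdj i j → Adj G (c i) (c j)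
    induced-from : ∀ i j → Adj G (c i) (c j) → CycAdj i j
open OddHole public

-- Perfection: every induced subgraph G[S] has chromatic number equal to
-- its clique number, i.e. there is k with a clique of size k inside S
-- and a proper k-colouring of G[S].
Perfect : ∀ {n} → Graph n → Set
Perfect {n} G = ∀ (S : Subset n) → ∃[ k ]
  ((∃[ Q ] (Q ⊆ S × IsClique G Q × ∣ Q ∣ ≡ k)) ×
   (Σ ((i : Fin n) → i ∈ S → Fin k) λ f → (∀ i j → (p : i ∈ S) → (q : j ∈ S) → Adj G i j →
                    f i p ≢ f j q)))

-- STAB(J): convex hull of incidence vectors of stable sets (over ℚ):
-- x is a convex combination Σ_j μ_j χ(S_j) of stable sets S_j.
inSTAB : ∀ {n} → Graph n → (Fin n → ℚ) → Set
inSTAB {n} G x = ∃[ L ]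
  (All (λ (p : ℚ × Subset n) → 0ℚ ≤ℚ proj₁ p × IsStable G (proj₂ p)) L ×
   foldrL (λ p s → proj₁ p +ℚ s) 0ℚ L ≡ 1ℚ ×
   (∀ v → x v ≡ foldrL (λ p s → (proj₁ p *ℚ χ (proj₂ p) v) +ℚ s) 0ℚ L))

Nonneg : ∀ {n} → (Fin n → ℚ) → Set
Nonneg x = ∀ v → 0ℚ ≤ℚ x v

OddHoleIneq : ∀ {n} {G : Graph n} {k} → OddHole G k → (Fin n → ℚ) → Set
OddHoleIneq {k = k} C x = sumFin (λ i → x (c C i)) ≤ℚ ((+ (k ∸ 1)) / 2)

inP : ∀ {n} → Graph n → (Fin n → ℚ) → Set
inP {n} G x = Nonneg x × (∀ (Q : Subset n) → IsClique G Q → xSum x Q ≤ℚ 1ℚ)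

HPerfect : ∀ {n} → Graph n → Set
HPerfect {n} G = ∀ (x : Fin n → ℚ) →
  inSTAB G x ⇔' (inP G x × (∀ k (C : OddHole G k) → OddHoleIneq C x))
  where
  _⇔'_ : Set → Set → Set
  A ⇔' B = (A → B) × (B → A)

ShortestOddHole : ∀ {n} → Graph n → ℕ → Set
ShortestOddHole G m = OddHole G m × (∀ k → OddHole G k → m ≤ k)

lam : ℕ → ℚ
lam ℓ = (+ (2 * ℓ)) / suc (2 * ℓ)

scale : ∀ {n} → ℚ → (Fin n → ℚ) → (Fin n → ℚ)
scale a x v = a *ℚ x v

-- Since J is h-perfect it suffices to check that λ x satisfies nonnegativity,
-- the clique inequalities and the odd-hole inequalities; the first two are
-- immediate from λ ≤ 1. For an odd hole C of length 2t+1, summing the edge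
-- inequalities x(u) + x(v) ≤ 1 around C gives 2 x(C) ≤ 2t+1, and since
-- ℓ ≤ t by minimality, λ_ℓ x(C) ≤ (2ℓ/(2ℓ+1)) (2t+1)/2 ≤ t = (|C| − 1)/2.
module Submission where

module RationalArithmetic where

  open import Data.Nat as ℕ using (ℕ; suc)
  import Data.Nat.Properties as ℕ
  open import Data.Integer as ℤ using (+_)
  import Data.Integer.Properties as ℤ
  open import Data.Rational
  open import Data.Rational.Properties
  import Data.Rational.Unnormalised as ℚᵘ
  import Data.Rational.Unnormalised.Properties as ℚᵘ
  open import Relation.Binary.PropositionalEquality

  fromℕ : ℕ → ℚ
  fromℕ n = + n / 1

  toℚᵘ-/ : ∀ i d → toℚᵘ (i / suc d) ℚᵘ.≃ ℚᵘ.mkℚᵘ i d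
  toℚᵘ-/ i d = toℚᵘ-fromℚᵘ (ℚᵘ.mkℚᵘ i d)

  mkℚᵘ-+ : ∀ m n → ℚᵘ.mkℚᵘ (+ (m ℕ.+ n)) 0 ℚᵘ.≃ ℚᵘ.mkℚᵘ (+ m) 0 ℚᵘ.+ ℚᵘ.mkℚᵘ (+ n) 0
  mkℚᵘ-+ m n = ℚᵘ.*≡* (begin
    + (m ℕ.+ n) ℤ.* + 1                    ≡⟨ ℤ.*-identityʳ _ ⟩
    + m ℤ.+ + n                            ≡⟨ cong₂ ℤ._+_ (ℤ.*-identityʳ (+ m)) (ℤ.*-identityʳ (+ n)) ⟨
    + m ℤ.* + 1 ℤ.+ + n ℤ.* + 1            ≡⟨ ℤ.*-identityʳ _ ⟨
    (+ m ℤ.* + 1 ℤ.+ + n ℤ.* + 1) ℤ.* + 1  ∎)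
    where open ≡-Reasoning

  mkℚᵘ-* : ∀ m n → ℚᵘ.mkℚᵘ (+ (m ℕ.* n)) 0 ℚᵘ.≃ ℚᵘ.mkℚᵘ (+ m) 0 ℚᵘ.* ℚᵘ.mkℚᵘ (+ n) 0
  mkℚᵘ-* m n = ℚᵘ.*≡* (begin
    + (m ℕ.* n) ℤ.* + 1      ≡⟨ ℤ.*-identityʳ _ ⟩
    + (m ℕ.* n)              ≡⟨ ℤ.pos-* m n ⟩
    + m ℤ.* + n              ≡⟨ ℤ.*-identityʳ _ ⟨
    (+ m ℤ.* + n) ℤ.* + 1    ∎)
    where open ≡-Reasoning

  fromℕ-+ : ∀ m n → fromℕ (m ℕ.+ n) ≡ fromℕ m + fromℕ n
  fromℕ-+ m n = toℚᵘ-injective (begin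
    toℚᵘ (fromℕ (m ℕ.+ n))                ≈⟨ toℚᵘ-/ _ 0 ⟩
    ℚᵘ.mkℚᵘ (+ (m ℕ.+ n)) 0               ≈⟨ mkℚᵘ-+ m n ⟩
    ℚᵘ.mkℚᵘ (+ m) 0 ℚᵘ.+ ℚᵘ.mkℚᵘ (+ n) 0  ≈⟨ ℚᵘ.+-cong (toℚᵘ-/ (+ m) 0) (toℚᵘ-/ (+ n) 0) ⟨
    toℚᵘ (fromℕ m) ℚᵘ.+ toℚᵘ (fromℕ n)    ≈⟨ toℚᵘ-homo-+ (fromℕ m) (fromℕ n) ⟨
    toℚᵘ (fromℕ m + fromℕ n)              ∎)
    where open ℚᵘ.≃-Reasoning

  fromℕ-* : ∀ m n → fromℕ (m ℕ.* n) ≡ fromℕ m * fromℕ n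
  fromℕ-* m n = toℚᵘ-injective (begin
    toℚᵘ (fromℕ (m ℕ.* n))                ≈⟨ toℚᵘ-/ _ 0 ⟩
    ℚᵘ.mkℚᵘ (+ (m ℕ.* n)) 0               ≈⟨ mkℚᵘ-* m n ⟩
    ℚᵘ.mkℚᵘ (+ m) 0 ℚᵘ.* ℚᵘ.mkℚᵘ (+ n) 0  ≈⟨ ℚᵘ.*-cong (toℚᵘ-/ (+ m) 0) (toℚᵘ-/ (+ n) 0) ⟨
    toℚᵘ (fromℕ m) ℚᵘ.* toℚᵘ (fromℕ n)    ≈⟨ toℚᵘ-homo-* (fromℕ m) (fromℕ n) ⟨
    toℚᵘ (fromℕ m * fromℕ n)              ∎)
    where open ℚᵘ.≃-Reasoning

  fromℕ-mono-≤ : ∀ {m n} → m ℕ.≤ n → fromℕ m ≤ fromℕ n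
  fromℕ-mono-≤ {m} {n} m≤n = toℚᵘ-cancel-≤
    (ℚᵘ.≤-respʳ-≃ (ℚᵘ.≃-sym (toℚᵘ-/ (+ n) 0)) (ℚᵘ.≤-respˡ-≃ (ℚᵘ.≃-sym (toℚᵘ-/ (+ m) 0))
      (ℚᵘ.*≤* (subst₂ ℤ._≤_ (sym (ℤ.*-identityʳ (+ m))) (sym (ℤ.*-identityʳ (+ n))) (ℤ.+≤+ m≤n)))))

  n/d*d≡n : ∀ n d → (+ n / suc d) * fromℕ (suc d) ≡ fromℕ n
  n/d*d≡n n d = toℚᵘ-injective (begin
    toℚᵘ ((+ n / suc d) * fromℕ (suc d))           ≈⟨ toℚᵘ-homo-* (+ n / suc d) (fromℕ (suc d)) ⟩
    toℚᵘ (+ n / suc d) ℚᵘ.* toℚᵘ (fromℕ (suc d))   ≈⟨ ℚᵘ.*-cong (toℚᵘ-/ (+ n) d) (toℚᵘ-/ (+ suc d) 0) ⟩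
    ℚᵘ.mkℚᵘ (+ n) d ℚᵘ.* ℚᵘ.mkℚᵘ (+ suc d) 0       ≈⟨ ℚᵘ.*≡* integral ⟩
    ℚᵘ.mkℚᵘ (+ n) 0                                ≈⟨ toℚᵘ-/ (+ n) 0 ⟨
    toℚᵘ (fromℕ n)                                 ∎)
    where
    open ℚᵘ.≃-Reasoning
    integral : (+ n ℤ.* + suc d) ℤ.* + 1 ≡ + n ℤ.* + (suc d ℕ.* 1)
    integral = trans (ℤ.*-identityʳ _) (cong (λ k → + n ℤ.* + k) (sym (ℕ.*-identityʳ (suc d))))

  fromℕ-pos : ∀ n → Positive (fromℕ (suc n))
  fromℕ-pos n = normalize-pos (suc n) 1

module Fractions where

  open import Data.Nat as ℕ using (suc)
  import Data.Nat.Properties as ℕ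
  open import Data.Integer using (+_)
  open import Data.Rational
  open import Data.Rational.Properties
  open import Data.Rational.Solver using (module +-*-Solver)
  open import Relation.Binary.PropositionalEquality
  open RationalArithmetic

  m*[1+n]≤n*[1+m] : ∀ {m n} → m ℕ.≤ n → m ℕ.* suc n ℕ.≤ n ℕ.* suc m
  m*[1+n]≤n*[1+m] {m} {n} m≤n = begin
    m ℕ.* suc n    ≡⟨ ℕ.*-suc m n ⟩
    m ℕ.+ m ℕ.* n  ≤⟨ ℕ.+-monoˡ-≤ (m ℕ.* n) m≤n ⟩
    n ℕ.+ m ℕ.* n  ≡⟨ cong (n ℕ.+_) (ℕ.*-comm m n) ⟩
    n ℕ.+ n ℕ.* m  ≡⟨ ℕ.*-suc n m ⟨
    n ℕ.* suc m    ∎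
    where open ℕ.≤-Reasoning

  n/[1+n]-nonNeg : ∀ n → NonNegative (+ n / suc n)
  n/[1+n]-nonNeg n = normalize-nonNeg n (suc n)

  n/[1+n]≤1 : ∀ n → + n / suc n ≤ 1ℚ
  n/[1+n]≤1 n = *-cancelʳ-≤-pos (fromℕ (suc n)) {{fromℕ-pos n}} (begin
    (+ n / suc n) * fromℕ (suc n)  ≡⟨ n/d*d≡n n n ⟩
    fromℕ n                        ≤⟨ fromℕ-mono-≤ (ℕ.n≤1+n n) ⟩
    fromℕ (suc n)                  ≡⟨ *-identityˡ (fromℕ (suc n)) ⟨
    1ℚ * fromℕ (suc n)             ∎)
    where open ≤-Reasoning

  n/[1+n]*p≤m/2 : ∀ {n m} p → n ℕ.≤ m → p + p ≤ fromℕ (suc m) → (+ n / suc n) * p ≤ + m / 2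
  n/[1+n]*p≤m/2 {n} {m} p n≤m p+p≤1+m =
    *-cancelʳ-≤-pos (fromℕ 2) {{fromℕ-pos 1}} (*-cancelʳ-≤-pos d {{fromℕ-pos n}} (begin
      ((f * p) * fromℕ 2) * d        ≡⟨ regroup f p d ⟩
      (f * d) * (p + p)              ≡⟨ cong (_* (p + p)) (n/d*d≡n n n) ⟩
      fromℕ n * (p + p)              ≤⟨ *-monoˡ-≤-nonNeg (fromℕ n) {{normalize-nonNeg n 1}} p+p≤1+m ⟩
      fromℕ n * fromℕ (suc m)        ≡⟨ fromℕ-* n (suc m) ⟨
      fromℕ (n ℕ.* suc m)            ≤⟨ fromℕ-mono-≤ (m*[1+n]≤n*[1+m] n≤m) ⟩
      fromℕ (m ℕ.* suc n)            ≡⟨ fromℕ-* m (suc n) ⟩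
      fromℕ m * d                    ≡⟨ cong (_* d) (n/d*d≡n m 1) ⟨
      ((+ m / 2) * fromℕ 2) * d      ∎))
    where
    open ≤-Reasoning
    f = + n / suc n
    d = fromℕ (suc n)
    regroup : ∀ a b c → ((a * b) * fromℕ 2) * c ≡ (a * c) * (b + b)
    regroup = solve 3 (λ a b c → ((a :* b) :* (con 1ℚ :+ con 1ℚ)) :* c := (a :* c) :* (b :+ b)) refl
      where open +-*-Solver

module FiniteSums where

  open import Defs using (sumFin; xSum)
  open import Data.Nat using (zero; suc)
  open import Data.Bool using (true; false; if_then_else_)
  open import Data.Fin as Fin using (Fin; zero; suc; inject₁)
  open import Data.Fin.Subset using (⁅_⁆; _∪_; ⊥)
  open import Data.Fin.Subset.Properties using (_∈?_; ∪-identityˡ; ∪-identityʳ)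
  open import Data.Rational
  open import Data.Rational.Properties
  open import Data.Rational.Solver using (module +-*-Solver)
  open import Function using (_∘_)
  open import Relation.Nullary using (contradiction; does)
  open import Relation.Binary.PropositionalEquality
  open RationalArithmetic

  sumFin-cong : ∀ {k} {f g : Fin k → ℚ} → (∀ i → f i ≡ g i) → sumFin f ≡ sumFin g
  sumFin-cong {zero}  f≗g = refl
  sumFin-cong {suc k} f≗g = cong₂ _+_ (f≗g zero) (sumFin-cong (f≗g ∘ suc))

  sumFin-mono-≤ : ∀ {k} {f g : Fin k → ℚ} → (∀ i → f i ≤ g i) → sumFin f ≤ sumFin g
  sumFin-mono-≤ {zero}  f≤g = ≤-refl
  sumFin-mono-≤ {suc k} f≤g = +-mono-≤ (f≤g zero) (sumFin-mono-≤ (f≤g ∘ suc))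

  sumFin-+ : ∀ {k} (f g : Fin k → ℚ) → sumFin (λ i → f i + g i) ≡ sumFin f + sumFin g
  sumFin-+ {zero}  f g = sym (+-identityˡ 0ℚ)
  sumFin-+ {suc k} f g = trans (cong (f zero + g zero +_) (sumFin-+ (f ∘ suc) (g ∘ suc)))
    (interchange (f zero) (g zero) (sumFin (f ∘ suc)) (sumFin (g ∘ suc)))
    where
    open +-*-Solver
    interchange : ∀ a b c d → (a + b) + (c + d) ≡ (a + c) + (b + d)
    interchange = solve 4 (λ a b c d → (a :+ b) :+ (c :+ d) := (a :+ c) :+ (b :+ d)) refl

  sumFin-*ˡ : ∀ {k} a (f : Fin k → ℚ) → sumFin (λ i → a * f i) ≡ a * sumFin f
  sumFin-*ˡ {zero}  a f = sym (*-zeroʳ a)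
  sumFin-*ˡ {suc k} a f = trans (cong (a * f zero +_) (sumFin-*ˡ a (f ∘ suc)))
    (sym (*-distribˡ-+ a (f zero) (sumFin (f ∘ suc))))

  sumFin-1 : ∀ k → sumFin {k} (λ _ → 1ℚ) ≡ fromℕ k
  sumFin-1 zero    = refl
  sumFin-1 (suc k) = trans (cong (1ℚ +_) (sumFin-1 k)) (sym (fromℕ-+ 1 k))

  prev : ∀ {m} → Fin (suc m) → Fin (suc m)
  prev {m} zero = Fin.fromℕ m
  prev (suc i)  = inject₁ i

  sumFin-last : ∀ m (f : Fin (suc m) → ℚ) → sumFin f ≡ sumFin (f ∘ inject₁) + f (Fin.fromℕ m)
  sumFin-last zero    f = trans (+-identityʳ (f zero)) (sym (+-identityˡ (f zero)))
  sumFin-last (suc m) f = trans (cong (f zero +_) (sumFin-last m (f ∘ suc)))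
    (sym (+-assoc (f zero) _ _))

  sumFin-prev : ∀ m (f : Fin (suc m) → ℚ) → sumFin (f ∘ prev) ≡ sumFin f
  sumFin-prev m f = trans (+-comm (f (Fin.fromℕ m)) _) (sym (sumFin-last m f))

  xSum-⊥ : ∀ {n} (x : Fin n → ℚ) → xSum x ⊥ ≡ 0ℚ
  xSum-⊥ {zero}  x = refl
  xSum-⊥ {suc n} x = trans (+-identityˡ _) (xSum-⊥ (x ∘ suc))

  xSum-⁅⁆ : ∀ {n} (x : Fin n → ℚ) a → xSum x ⁅ a ⁆ ≡ x a
  xSum-⁅⁆ x zero    = trans (cong (x zero +_) (xSum-⊥ (x ∘ suc))) (+-identityʳ (x zero))
  xSum-⁅⁆ x (suc a) = trans (+-identityˡ _) (xSum-⁅⁆ (x ∘ suc) a)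

  xSum-⁅⁆∪⁅⁆ : ∀ {n} (x : Fin n → ℚ) {a b} → a ≢ b → xSum x (⁅ a ⁆ ∪ ⁅ b ⁆) ≡ x a + x b
  xSum-⁅⁆∪⁅⁆ x {zero}  {zero}  a≢b = contradiction refl a≢b
  xSum-⁅⁆∪⁅⁆ x {zero}  {suc b} a≢b = cong (x zero +_)
    (trans (cong (xSum (x ∘ suc)) (∪-identityˡ ⁅ b ⁆)) (xSum-⁅⁆ (x ∘ suc) b))
  xSum-⁅⁆∪⁅⁆ x {suc a} {zero}  a≢b = trans (cong (x zero +_)
    (trans (cong (xSum (x ∘ suc)) (∪-identityʳ ⁅ a ⁆)) (xSum-⁅⁆ (x ∘ suc) a))) (+-comm (x zero) (x (suc a)))
  xSum-⁅⁆∪⁅⁆ x {suc a} {suc b} a≢b =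
    trans (+-identityˡ _) (xSum-⁅⁆∪⁅⁆ (x ∘ suc) (a≢b ∘ cong suc))

  xSum-*ˡ : ∀ {n} a (x : Fin n → ℚ) Q → xSum (λ i → a * x i) Q ≡ a * xSum x Q
  xSum-*ˡ a x Q = trans (sumFin-cong (λ i → *-if (does (i ∈? Q))))
    (sumFin-*ˡ a (λ i → if does (i ∈? Q) then x i else 0ℚ))
    where
    *-if : ∀ {u} b → (if b then a * u else 0ℚ) ≡ a * (if b then u else 0ℚ)
    *-if true  = refl
    *-if false = sym (*-zeroʳ a)

module EdgeInequalities where

  open import Defs hiding (sym)
  open import Data.Nat using (suc)
  open import Data.Fin using (Fin; zero; suc)
  open import Data.Fin.Properties using (toℕ-fromℕ; toℕ-inject₁)
  open import Data.Fin.Subset using (⁅_⁆; _∪_; _∈_)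
  open import Data.Fin.Subset.Properties using (x∈⁅y⁆⇒x≡y; x∈p∪q⁻)
  open import Data.Rational using (ℚ; 1ℚ; _+_; _≤_)
  open import Data.Rational.Properties using (module ≤-Reasoning)
  open import Data.Product using (_,_; proj₂)
  open import Data.Sum as Sum using (_⊎_; inj₁; inj₂)
  open import Function using (_∘_)
  open import Relation.Nullary using (contradiction)
  open import Relation.Binary.PropositionalEquality
  open RationalArithmetic
  open FiniteSums

  Adj⇒≢ : ∀ {n} (J : Graph n) {a b} → Adj J a b → a ≢ b
  Adj⇒≢ J {a} ab refl with () ← trans (sym ab) (irrefl J a)

  ∈⁅⁆∪⁅⁆⇒≡ : ∀ {n} {a b i : Fin n} → i ∈ ⁅ a ⁆ ∪ ⁅ b ⁆ → i ≡ a ⊎ i ≡ b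
  ∈⁅⁆∪⁅⁆⇒≡ {a = a} {b} = Sum.map (x∈⁅y⁆⇒x≡y a) (x∈⁅y⁆⇒x≡y b) ∘ x∈p∪q⁻ ⁅ a ⁆ ⁅ b ⁆

  edge-isClique : ∀ {n} (J : Graph n) {a b} → Adj J a b → IsClique J (⁅ a ⁆ ∪ ⁅ b ⁆)
  edge-isClique J {a} {b} ab i j i∈ j∈ i≢j with ∈⁅⁆∪⁅⁆⇒≡ i∈ | ∈⁅⁆∪⁅⁆⇒≡ j∈
  ... | inj₁ refl | inj₁ refl = contradiction refl i≢j
  ... | inj₁ refl | inj₂ refl = ab
  ... | inj₂ refl | inj₁ refl = trans (Graph.sym J b a) ab
  ... | inj₂ refl | inj₂ refl = contradiction refl i≢j

  inP⇒edge-≤1 : ∀ {n} (J : Graph n) {x : Fin n → ℚ} → inP J x →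
                ∀ {a b} → Adj J a b → x a + x b ≤ 1ℚ
  inP⇒edge-≤1 J {x} x∈P ab =
    subst (_≤ 1ℚ) (xSum-⁅⁆∪⁅⁆ x (Adj⇒≢ J ab)) (proj₂ x∈P _ (edge-isClique J ab))

  -- Each term of a cyclic sequence is counted in two consecutive pairs.
  cyclic-double-sum-≤ : ∀ m (y : Fin (suc m) → ℚ) → (∀ i → y (prev i) + y i ≤ 1ℚ) →
                        sumFin y + sumFin y ≤ fromℕ (suc m)
  cyclic-double-sum-≤ m y pairs≤1 = begin
    sumFin y + sumFin y               ≡⟨ cong (_+ sumFin y) (sumFin-prev m y) ⟨
    sumFin (y ∘ prev) + sumFin y      ≡⟨ sumFin-+ (y ∘ prev) y ⟨
    sumFin (λ i → y (prev i) + y i)   ≤⟨ sumFin-mono-≤ pairs≤1 ⟩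
    sumFin {suc m} (λ _ → 1ℚ)         ≡⟨ sumFin-1 (suc m) ⟩
    fromℕ (suc m)                     ∎
    where open ≤-Reasoning

  prev-CycAdj : ∀ {m} (i : Fin (suc m)) → CycAdj (prev i) i
  prev-CycAdj {m} zero = inj₁ (inj₂ (cong suc (toℕ-fromℕ m) , refl))
  prev-CycAdj (suc i)  = inj₁ (inj₁ (cong suc (sym (toℕ-inject₁ i))))

  oddHole-double-sum-≤ : ∀ {n} (J : Graph n) {x : Fin n → ℚ} → inP J x →
                         ∀ {m} (C : OddHole J (suc m)) →
                         sumFin (x ∘ c C) + sumFin (x ∘ c C) ≤ fromℕ (suc m)
  oddHole-double-sum-≤ J {x} x∈P {m} C = cyclic-double-sum-≤ m (x ∘ c C)
    (λ i → inP⇒edge-≤1 J x∈P (induced-to C (prev i) i (prev-CycAdj i)))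

module Scaling where

  open import Defs hiding (sym)
  open import Data.Nat as ℕ using (suc; _*_)
  import Data.Nat.Properties as ℕ
  open import Data.Integer using (+_)
  open import Data.Fin using (Fin)
  open import Data.Rational using (ℚ; 1ℚ; _≤_; _/_; NonNegative) renaming (_*_ to _·_)
  open import Data.Rational.Properties using (*-zeroʳ; *-identityʳ; *-monoˡ-≤-nonNeg; module ≤-Reasoning)
  open import Data.Product using (_,_)
  open import Function using (_∘_)
  open import Relation.Binary.PropositionalEquality using (refl; subst)
  open Fractions
  open FiniteSums
  open EdgeInequalities

  inP-scale : ∀ {n} (J : Graph n) a .{{_ : NonNegative a}} → a ≤ 1ℚ →
              ∀ {x : Fin n → ℚ} → inP J x → inP J (scale a x)
  inP-scale J a a≤1 {x} (x≥0 , clique≤1) = ax≥0 , clique-ax≤1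
    where
    ax≥0 : Nonneg (scale a x)
    ax≥0 v = subst (_≤ a · x v) (*-zeroʳ a) (*-monoˡ-≤-nonNeg a (x≥0 v))
    clique-ax≤1 : ∀ Q → IsClique J Q → xSum (scale a x) Q ≤ 1ℚ
    clique-ax≤1 Q Q-clique = begin
      xSum (scale a x) Q  ≡⟨ xSum-*ˡ a x Q ⟩
      a · xSum x Q        ≤⟨ *-monoˡ-≤-nonNeg a (clique≤1 Q Q-clique) ⟩
      a · 1ℚ              ≡⟨ *-identityʳ a ⟩
      a                   ≤⟨ a≤1 ⟩
      1ℚ                  ∎
      where open ≤-Reasoning

  scale-lam-oddHoleIneq : ∀ {n} (J : Graph n) ℓ → (∀ k → OddHole J k → suc (2 * ℓ) ℕ.≤ k) →
                          ∀ {x : Fin n → ℚ} → inP J x →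
                          ∀ k (C : OddHole J k) → OddHoleIneq C (scale (lam ℓ) x)
  scale-lam-oddHoleIneq J ℓ shortest {x} x∈P k C with odd C
  ... | t , refl = begin
    sumFin (scale (lam ℓ) x ∘ c C)  ≡⟨ sumFin-*ˡ (lam ℓ) (x ∘ c C) ⟩
    lam ℓ · sumFin (x ∘ c C)        ≤⟨ n/[1+n]*p≤m/2 _ 2ℓ≤2t (oddHole-double-sum-≤ J x∈P C) ⟩
    + (2 * t) / 2                   ∎
    where
    open ≤-Reasoning
    2ℓ≤2t : 2 * ℓ ℕ.≤ 2 * t
    2ℓ≤2t = ℕ.s≤s⁻¹ (shortest (suc (2 * t)) C)

open import Defs
open import Data.Nat using (ℕ; suc; _*_)
open import Data.Fin using (Fin)
open import Data.Rational using (ℚ)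
open import Relation.Nullary using (¬_)
open import Data.Product using (_,_; proj₂)
open Fractions using (n/[1+n]-nonNeg; n/[1+n]≤1)
open Scaling

mainTheorem3 : ∀ (n : ℕ) (J : Graph n) → HPerfect J → ¬ Perfect J →
    ∀ (ℓ : ℕ) → ShortestOddHole J (suc (2 * ℓ)) →
    ∀ (x : Fin n → ℚ) → inP J x → inSTAB J (scale (lam ℓ) x)
mainTheorem3 n J J-hPerfect _ ℓ (_ , shortest) x x∈P =
  proj₂ (J-hPerfect (scale (lam ℓ) x))
    ( inP-scale J (lam ℓ) {{n/[1+n]-nonNeg (2 * ℓ)}} (n/[1+n]≤1 (2 * ℓ)) x∈P
    , scale-lam-oddHoleIneq J ℓ shortest x∈P )
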